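{- For any $\phi\in \mathrm{PL}(=\!(\cdot))$, $\phi$ and $\neg \phi$ are ground-complementary: $|\phi|_\mathsf{X}=|\top|_\mathsf{X}\setminus|\neg\phi|_\mathsf{X}$ and $|\neg\phi|_\mathsf{X}=|\top|_\mathsf{X}\setminus|\phi|_\mathsf{X}$ for all $\mathsf{X}\supseteq\mathsf{P}(\phi)$.
   Context: Propositional dependence logic $\mathrm{PL}(=\!(\cdot))$: $\phi ::= p \mid \bot \mid \neg\phi \mid \phi\wedge\phi \mid \phi\vee\phi \mid {=}\!(p_1,\ldots,p_n,q)$, on propositional teams with support $\models$ / anti-support $\models^-$: $p$ supported iff all $w\in s$ make $p$ true, anti-supported iff none do; $s\models\bot$ iff $s=\emptyset$, $\bot$ always anti-supported; $s\models{=}\!(p_1,\ldots,p_n,q)$ iff any $v,w\in s$ agreeing on all $p_i$ agree on $q$, and it is anti-supported iff $s=\emptyset$; $\neg$ swaps support and anti-support; $\wedge$ supported iff both are, anti-supported iff $s=t\cup u$ with $t\models^-\phi,u\models^-\psi$; $\vee$ supported iff $s=t\cup u$ with $t\models\phi,u\models\psi$, anti-supported iff both are. $\top:=\neg\bot$; ground team $|\phi|_\mathsf{X}$: valuations over $\mathsf{X}$ belonging to some team over $\mathsf{X}$ supporting $\phi$ (so $|\top|_\mathsf{X}=2^\mathsf{X}$). -}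

module Defs where

open import Data.Nat using (ℕ; _≟_)
open import Data.Bool using (Bool; true; false; _∨_)
open import Data.List using (List; []; _∷_; _++_; length)
open import Data.Vec using (Vec; []; _∷_)
open import Data.Product using (Σ; _×_; _,_)
open import Data.Unit using (⊤)
open import Data.Empty using (⊥)
open import Relation.Nullary using (¬_; yes; no)
open import Relation.Binary.PropositionalEquality using (_≡_)
open import Data.List.Membership.Propositional using (_∈_)

data Form : Set where
  atom : ℕ → Form
  bot  : Form
  neg  : Form → Form
  _∧'_ : Form → Form → Form
  _∨'_ : Form → Form → Form
  dep  : List ℕ → ℕ → Form    -- dep (p₁ ∷ … ∷ pₙ ∷ []) q  is  =(p₁,…,pₙ,q)

top : Form
top = neg bot

atoms : Form → List ℕ
atoms (atom p)   = p ∷ []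
atoms bot        = []
atoms (neg φ)    = atoms φ
atoms (φ ∧' ψ)   = atoms φ ++ atoms ψ
atoms (φ ∨' ψ)   = atoms φ ++ atoms ψ
atoms (dep ps q) = ps ++ (q ∷ [])

-- A finite set of atoms X is a duplicate-free list; a valuation over X
-- assigns a truth value to each listed atom (in order).
Val : List ℕ → Set
Val X = Vec Bool (length X)

-- value of atom p under valuation w over X (default false if p ∉ X;
-- irrelevant when P(φ) ⊆ X)
at : (X : List ℕ) → Val X → ℕ → Bool
at []      []      p = false
at (x ∷ X) (b ∷ w) p with p ≟ x
... | yes _ = b
... | no  _ = at X w p

Team : List ℕ → Set
Team X = Val X → Bool

Union : (X : List ℕ) → Team X → Team X → Team X → Set
Union X s t u = ∀ w → s w ≡ (t w ∨ u w)

mutual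
  Sup : (X : List ℕ) → Form → Team X → Set
  Sup X (atom p) s = ∀ w → s w ≡ true → at X w p ≡ true
  Sup X bot s = ∀ w → s w ≡ false
  Sup X (neg φ) s = ASup X φ s
  Sup X (φ ∧' ψ) s = Sup X φ s × Sup X ψ s
  Sup X (φ ∨' ψ) s = Σ (Team X) λ t → Σ (Team X) λ u → Union X s t u × Sup X φ t × Sup X ψ u
  Sup X (dep ps q) s = ∀ v w → s v ≡ true → s w ≡ true →
                         (∀ {p} → p ∈ ps → at X v p ≡ at X w p) → at X v q ≡ at X w q

  ASup : (X : List ℕ) → Form → Team X → Set
  ASup X (atom p) s = ∀ w → s w ≡ true → at X w p ≡ false
  ASup X bot s = ⊤
  ASup X (neg φ) s = Sup X φ s
  ASup X (φ ∧' ψ) s = Σ (Team X) λ t → Σ (Team X) λ u → Union X s t u × ASup X φ t × ASup X ψ u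
  ASup X (φ ∨' ψ) s = ASup X φ s × ASup X ψ s
  ASup X (dep ps q) s = ∀ w → s w ≡ false

Ground : (X : List ℕ) → Form → Val X → Set
Ground X φ v = Σ (Team X) λ s → Sup X φ s × (s v ≡ true)

{-# OPTIONS --safe #-}
-- Support and anti-support of φ are exclusive on each valuation: by induction on
-- φ, no valuation lies both in a team supporting φ and in one anti-supporting it.
-- They are also exhaustive on singletons: every formula is supported or
-- anti-supported by {v}, the splitting cases writing {v} as {v} ∪ ∅ or ∅ ∪ {v}, since
-- the empty team supports and anti-supports everything. Hence v ∈ |φ|_X exactly
-- when v ∉ |¬φ|_X, and |⊤|_X contains every valuation.
module Submission where

open import Defs
open import Data.Nat using (ℕ)
open import Data.List using (List)
open import Data.List.Relation.Unary.Unique.Propositional using (Unique)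
open import Data.List.Relation.Binary.Subset.Propositional using (_⊆_)
open import Data.Bool using (true; false; _∨_)
import Data.Bool.Properties as Bool
open import Data.Vec.Properties using (≡-dec)
open import Data.Product using (_×_; _,_)
open import Data.Sum using (_⊎_; inj₁; inj₂; fromInj₁)
open import Data.Unit using (tt)
open import Data.Empty using (⊥; ⊥-elim)
open import Function.Base using (_∘_)
open import Function.Bundles using (_⇔_; mk⇔)
open import Relation.Nullary using (¬_; yes; no; does)
open import Relation.Nullary.Decidable using (dec-true)
open import Relation.Binary.PropositionalEquality using (_≡_; refl; sym; trans; cong)

∨-true : ∀ a b → a ∨ b ≡ true → a ≡ true ⊎ b ≡ true
∨-true true  _ _    = inj₁ refl
∨-true false _ b≡tt = inj₂ b≡tt

module _ {X : List ℕ} where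

  Sup-ASup-disjoint : ∀ φ {s t : Team X} {v} → Sup X φ s → ASup X φ t →
                      s v ≡ true → t v ≡ true → ⊥
  Sup-ASup-disjoint (atom p) {v = v} S A sv tv with () ← trans (sym (S v sv)) (A v tv)
  Sup-ASup-disjoint bot {v = v} S _ sv _ with () ← trans (sym sv) (S v)
  Sup-ASup-disjoint (neg φ) S A sv tv = Sup-ASup-disjoint φ A S tv sv
  Sup-ASup-disjoint (φ ∧' ψ) {v = v} (Sφ , Sψ) (t₁ , t₂ , t≡t₁∪t₂ , Aφ , Aψ) sv tv
    with ∨-true (t₁ v) (t₂ v) (trans (sym (t≡t₁∪t₂ v)) tv)
  ... | inj₁ t₁v = Sup-ASup-disjoint φ Sφ Aφ sv t₁v
  ... | inj₂ t₂v = Sup-ASup-disjoint ψ Sψ Aψ sv t₂v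
  Sup-ASup-disjoint (φ ∨' ψ) {v = v} (s₁ , s₂ , s≡s₁∪s₂ , Sφ , Sψ) (Aφ , Aψ) sv tv
    with ∨-true (s₁ v) (s₂ v) (trans (sym (s≡s₁∪s₂ v)) sv)
  ... | inj₁ s₁v = Sup-ASup-disjoint φ Sφ Aφ s₁v tv
  ... | inj₂ s₂v = Sup-ASup-disjoint ψ Sψ Aψ s₂v tv
  Sup-ASup-disjoint (dep ps q) {v = v} _ A _ tv with () ← trans (sym tv) (A v)

  ∅ : Team X
  ∅ _ = false

  ∪-identityʳ : (s : Team X) → Union X s s ∅
  ∪-identityʳ s w = sym (Bool.∨-identityʳ (s w))

  ∪-identityˡ : (s : Team X) → Union X s ∅ s
  ∪-identityˡ s w = refl

  mutual
    ∅-Sup : ∀ φ → Sup X φ ∅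
    ∅-Sup (atom p)   = λ _ ()
    ∅-Sup bot        = λ _ → refl
    ∅-Sup (neg φ)    = ∅-ASup φ
    ∅-Sup (φ ∧' ψ)   = ∅-Sup φ , ∅-Sup ψ
    ∅-Sup (φ ∨' ψ)   = ∅ , ∅ , ∪-identityʳ ∅ , ∅-Sup φ , ∅-Sup ψ
    ∅-Sup (dep ps q) = λ _ _ ()

    ∅-ASup : ∀ φ → ASup X φ ∅
    ∅-ASup (atom p)   = λ _ ()
    ∅-ASup bot        = tt
    ∅-ASup (neg φ)    = ∅-Sup φ
    ∅-ASup (φ ∧' ψ)   = ∅ , ∅ , ∪-identityʳ ∅ , ∅-ASup φ , ∅-ASup ψ
    ∅-ASup (φ ∨' ψ)   = ∅-ASup φ , ∅-ASup ψ
    ∅-ASup (dep ps q) = λ _ → refl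

  _⊆⁅_⁆ : Team X → Val X → Set
  s ⊆⁅ v ⁆ = ∀ w → s w ≡ true → w ≡ v

  subsingleton-Sup⊎ASup : ∀ φ {s : Team X} {v} → s ⊆⁅ v ⁆ → Sup X φ s ⊎ ASup X φ s
  subsingleton-Sup⊎ASup (atom p) {v = v} s⊆v with at X v p in atv
  ... | true  = inj₁ λ w sw → trans (cong (λ u → at X u p) (s⊆v w sw)) atv
  ... | false = inj₂ λ w sw → trans (cong (λ u → at X u p) (s⊆v w sw)) atv
  subsingleton-Sup⊎ASup bot _ = inj₂ tt
  subsingleton-Sup⊎ASup (neg φ) s⊆v with subsingleton-Sup⊎ASup φ s⊆v
  ... | inj₁ S = inj₂ S
  ... | inj₂ A = inj₁ A
  subsingleton-Sup⊎ASup (φ ∧' ψ) {s} s⊆v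
    with subsingleton-Sup⊎ASup φ s⊆v | subsingleton-Sup⊎ASup ψ s⊆v
  ... | inj₁ Sφ | inj₁ Sψ = inj₁ (Sφ , Sψ)
  ... | inj₂ Aφ | _       = inj₂ (s , ∅ , ∪-identityʳ s , Aφ , ∅-ASup ψ)
  ... | inj₁ _  | inj₂ Aψ = inj₂ (∅ , s , ∪-identityˡ s , ∅-ASup φ , Aψ)
  subsingleton-Sup⊎ASup (φ ∨' ψ) {s} s⊆v
    with subsingleton-Sup⊎ASup φ s⊆v | subsingleton-Sup⊎ASup ψ s⊆v
  ... | inj₂ Aφ | inj₂ Aψ = inj₂ (Aφ , Aψ)
  ... | inj₁ Sφ | _       = inj₁ (s , ∅ , ∪-identityʳ s , Sφ , ∅-Sup ψ)
  ... | inj₂ _  | inj₁ Sψ = inj₁ (∅ , s , ∪-identityˡ s , ∅-Sup φ , Sψ)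
  subsingleton-Sup⊎ASup (dep ps q) s⊆v =
    inj₁ λ u w su sw _ → cong (λ z → at X z q) (trans (s⊆v u su) (sym (s⊆v w sw)))

  ⁅_⁆ : Val X → Team X
  ⁅ v ⁆ w = does (≡-dec Bool._≟_ w v)

  ⁅⁆-⊆ : (v : Val X) → ⁅ v ⁆ ⊆⁅ v ⁆
  ⁅⁆-⊆ v w _  with ≡-dec Bool._≟_ w v
  ⁅⁆-⊆ v w _  | yes w≡v = w≡v
  ⁅⁆-⊆ v w () | no _

  ⁅⁆-∋ : (v : Val X) → ⁅ v ⁆ v ≡ true
  ⁅⁆-∋ v = dec-true (≡-dec Bool._≟_ v v) refl

  Ground-top : (v : Val X) → Ground X top v
  Ground-top v = (λ _ → true) , tt , refl

  Ground-disjoint : (φ : Form) (v : Val X) →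
                    Ground X φ v → ¬ Ground X (neg φ) v
  Ground-disjoint φ v (s , S , sv) (t , A , tv) = Sup-ASup-disjoint φ S A sv tv

  Ground-exhaustive : (φ : Form) (v : Val X) →
                      Ground X φ v ⊎ Ground X (neg φ) v
  Ground-exhaustive φ v with subsingleton-Sup⊎ASup φ (⁅⁆-⊆ v)
  ... | inj₁ S = inj₁ (⁅ v ⁆ , S , ⁅⁆-∋ v)
  ... | inj₂ A = inj₂ (⁅ v ⁆ , A , ⁅⁆-∋ v)

  Ground-complement : (φ : Form) (v : Val X) →
                      Ground X φ v ⇔ (Ground X top v × ¬ Ground X (neg φ) v)
  Ground-complement φ v = mk⇔
    (λ v∈φ → Ground-top v , Ground-disjoint φ v v∈φ)
    (λ (_ , v∉¬φ) → fromInj₁ (⊥-elim ∘ v∉¬φ) (Ground-exhaustive φ v))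

-- Valuations assign false to atoms outside X.
-- The second half is the first for ¬φ, as Sup X (neg (neg φ)) reduces to Sup X φ.
proposition3p30 : (φ : Form) (X : List ℕ) → Unique X → atoms φ ⊆ X →
    ((v : Val X) → Ground X φ v ⇔ (Ground X top v × ¬ Ground X (neg φ) v))
    × ((v : Val X) → Ground X (neg φ) v ⇔ (Ground X top v × ¬ Ground X φ v))
proposition3p30 φ X _ _ = Ground-complement {X} φ , Ground-complement {X} (neg φ)
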